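{- Let $A$ be a set, $(\mathcal B_i)_{i\in I}$ a family of finiteness spaces and $(f_i)_{i\in I}$ a family of relations $f_i\subseteq A\times|\mathcal B_i|$ such that $f_i[\{\alpha\}]\in\mathfrak F(\mathcal B_i)$ for all $\alpha\in A$ and all $i\in I$. Then $\mathfrak T=\{a\subseteq A:\ \forall i\in I,\ f_i[a]\in\mathfrak F(\mathcal B_i)\}$ is a finiteness structure on $A$, and $\mathfrak T=\Big(\big\{\textstyle\bigcap_{i\in I}(f_i\backslash b_i):\ (b_i)_{i\in I}\text{ with } b_i\in\mathfrak F(\mathcal B_i)\text{ for all }i\big\}^{\perp}\Big)^{\perp}$, the preduals being taken on $A$.
   Context: For a set $A$ and $\mathfrak A\subseteq\mathcal P(A)$, $\mathfrak A^{\perp}=\{a'\subseteq A:\ a\cap a'\text{ finite for all }a\in\mathfrak A\}$. A finiteness structure on $A$ is $\mathfrak A\subseteq\mathcal P(A)$ with $(\mathfrak A^\perp)^\perp=\mathfrak A$. A finiteness space $\mathcal B$ is a pair $(|\mathcal B|,\mathfrak F(\mathcal B))$ of a set and a finiteness structure on it. For a relation $f\subseteq A\times B$: $f[a]=\{\beta:\exists\alpha\in a,\ (\alpha,\beta)\in f\}$ for $a\subseteq A$, and $f\backslash b=\{\alpha\in A:\ f[\{\alpha\}]\subseteq b\}$ for $b\subseteq B$. -}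

module Defs where

open import Level using (Level; 0ℓ; _⊔_) renaming (suc to lsuc)
open import Data.List using (List)
open import Data.List.Membership.Propositional using (_∈_)
open import Data.Product using (Σ; ∃; _×_; _,_)
open import Relation.Binary.PropositionalEquality using (_≡_)
open import Relation.Unary using (Pred; _⊆_; _∩_)

Subset : Set → Set₁
Subset A = Pred A 0ℓ

_≐_ : ∀ {a ℓ₁ ℓ₂} {X : Set a} → Pred X ℓ₁ → Pred X ℓ₂ → Set (a ⊔ ℓ₁ ⊔ ℓ₂)
P ≐ Q = (P ⊆ Q) × (Q ⊆ P)

Finite : {A : Set} → Subset A → Set
Finite {A} P = Σ (List A) (λ xs → ∀ x → P x → x ∈ xs)

_⊥ : ∀ {A : Set} {ℓ} → Pred (Subset A) ℓ → Pred (Subset A) (lsuc 0ℓ ⊔ ℓ)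
(𝔄 ⊥) a′ = ∀ (a : Subset _) → 𝔄 a → Finite (a ∩ a′)

IsFinitenessStructure : ∀ {A : Set} {ℓ} → Pred (Subset A) ℓ → Set (lsuc 0ℓ ⊔ ℓ)
IsFinitenessStructure 𝔄 = ((𝔄 ⊥) ⊥) ≐ 𝔄

record FinitenessSpace : Set₂ where
  field
    web    : Set
    𝔉      : Pred (Subset web) (lsuc 0ℓ)
    isFS   : IsFinitenessStructure 𝔉
open FinitenessSpace public

Rel : Set → Set → Set₁
Rel A B = A → B → Set

_[_] : ∀ {A B : Set} → Rel A B → Subset A → Subset B
(f [ a ]) β = ∃ λ α → a α × f α β

_╲_ : ∀ {A B : Set} → Rel A B → Subset B → Subset A
(f ╲ b) α = ∀ β → f α β → b β

｛_｝ : ∀ {A : Set} → A → Subset A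
｛ α ｝ x = x ≡ α

InterFamily : ∀ {A I : Set} (ℬ : I → FinitenessSpace) (f : (i : I) → Rel A (web (ℬ i)))
            → Pred (Subset A) (lsuc 0ℓ)
InterFamily {A} {I} ℬ f c =
  Σ ((i : I) → Subset (web (ℬ i))) λ b →
    ((i : I) → 𝔉 (ℬ i) (b i)) × (c ≐ (λ α → (i : I) → (f i ╲ b i) α))

𝔗 : ∀ {A I : Set} (ℬ : I → FinitenessSpace) (f : (i : I) → Rel A (web (ℬ i)))
  → Pred (Subset A) (lsuc 0ℓ)
𝔗 {A} {I} ℬ f a = (i : I) → 𝔉 (ℬ i) (f i [ a ])

module Submission where

-- For that equation:
--   • 𝔗 ⊆ 𝔇⊥⊥, since every a lies in ⋂ᵢ (fᵢ \ fᵢ[a]), which is in 𝔇 when a ∈ 𝔗;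
--   • 𝔇⊥⊥ ⊆ 𝔗: given b′ ∈ 𝔉(ℬᵢ)⊥, choose (by excluded middle) one witness
--     α ∈ a for each β ∈ fᵢ[a] ∩ b′.  The set C of chosen witnesses meets each
--     fᵢ \ b finitely when b ∩ b′ is finite, so C ∈ 𝔇⊥ and C ∩ a is finite;
--     hence fᵢ[a] ∩ b′ ⊆ ⋃_{α ∈ C ∩ a} fᵢ[{α}] ∩ b′ is a finite union of finite
--     sets, i.e. fᵢ[a] ∈ 𝔉(ℬᵢ)⊥⊥ = 𝔉(ℬᵢ).

open import Defs
open import Level using (Level; 0ℓ) renaming (suc to lsuc)
open import Axiom.ExcludedMiddle using (ExcludedMiddle)
open import Data.Product using (_×_; _,_; proj₁; proj₂; ∃)
open import Data.List using (List; []; _∷_; concatMap)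
open import Data.List.Membership.Propositional using (_∈_; lose)
open import Data.List.Membership.Propositional.Properties using (∈-concatMap⁺)
open import Data.List.Relation.Unary.Any using (here)
open import Function using (id)
open import Relation.Nullary using (yes; no; contradiction)
open import Relation.Binary.PropositionalEquality using (refl)
open import Relation.Unary using (Pred; _⊆_; _∩_)

private
  variable
    ℓ ℓ′ : Level
    X Y : Set

Finite-⊆ : {P Q : Subset X} → P ⊆ Q → Finite Q → Finite P
Finite-⊆ P⊆Q (xs , Q⊆xs) = xs , λ x p → Q⊆xs x (P⊆Q p)

Finite-⋃ : (P : Subset X) (R : X → Subset Y) → Finite P → ((x : X) → Finite (R x))
         → Finite (λ y → ∃ λ x → P x × R x y)
Finite-⋃ P R (xs , P⊆xs) R-fin =
  concatMap (λ x → proj₁ (R-fin x)) xs ,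
  λ y (x , Px , Rxy) → ∈-concatMap⁺ _ (lose (P⊆xs x Px) (proj₂ (R-fin x) y Rxy))

⊥-antitone : {𝔄 : Pred (Subset X) ℓ} {𝔅 : Pred (Subset X) ℓ′} → 𝔄 ⊆ 𝔅 → (𝔅 ⊥) ⊆ (𝔄 ⊥)
⊥-antitone 𝔄⊆𝔅 b′⊥ a a∈𝔄 = b′⊥ a (𝔄⊆𝔅 a∈𝔄)

⊆-⊥⊥ : {𝔄 : Pred (Subset X) ℓ} → 𝔄 ⊆ ((𝔄 ⊥) ⊥)
⊆-⊥⊥ a∈𝔄 a′ a′⊥ = Finite-⊆ (λ (a′x , ax) → ax , a′x) (a′⊥ _ a∈𝔄)

⊥-isFinitenessStructure : (𝔄 : Pred (Subset X) ℓ) → IsFinitenessStructure (𝔄 ⊥)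
⊥-isFinitenessStructure 𝔄 = ⊥-antitone {𝔄 = 𝔄} (⊆-⊥⊥ {𝔄 = 𝔄}) , ⊆-⊥⊥ {𝔄 = 𝔄 ⊥}

IsFinitenessStructure-≐ : {𝔄 : Pred (Subset X) ℓ} {𝔅 : Pred (Subset X) ℓ′}
                        → 𝔄 ≐ 𝔅 → IsFinitenessStructure 𝔅 → IsFinitenessStructure 𝔄
IsFinitenessStructure-≐ {𝔄 = 𝔄} {𝔅} (𝔄⊆𝔅 , 𝔅⊆𝔄) (𝔅⊥⊥⊆𝔅 , _) =
  (λ a∈𝔄⊥⊥ → 𝔅⊆𝔄 (𝔅⊥⊥⊆𝔅 (⊥-antitone {𝔄 = 𝔅 ⊥} (⊥-antitone {𝔄 = 𝔄} 𝔄⊆𝔅) a∈𝔄⊥⊥))) ,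
  ⊆-⊥⊥ {𝔄 = 𝔄}

⊆-╲-image : {A B : Set} (f : Rel A B) {a : Subset A} → a ⊆ (f ╲ (f [ a ]))
⊆-╲-image f aα β fαβ = _ , aα , fαβ

module Witnesses (em : ExcludedMiddle 0ℓ) (R : Y → X → Set) where

  witness : Y → List X
  witness y with em {∃ (R y)}
  ... | yes (x , _) = x ∷ []
  ... | no _        = []

  witness-sound : ∀ {y x} → x ∈ witness y → R y x
  witness-sound {y} x∈w with em {∃ (R y)}
  witness-sound (here refl) | yes (_ , Ryx) = Ryx
  witness-sound ()          | no _

  witness-complete : ∀ {y} → ∃ (R y) → ∃ λ x → x ∈ witness y
  witness-complete {y} Ry with em {∃ (R y)}
  ... | yes (x , _) = x , here refl
  ... | no ¬Ry      = contradiction Ry ¬Ry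

  Witnessed : Subset X
  Witnessed x = ∃ λ y → x ∈ witness y

module ImageWitnesses (em : ExcludedMiddle 0ℓ) {A B : Set} (g : Rel A B)
                      (a : Subset A) (b′ : Subset B) where

  open Witnesses em (λ β α → a α × g α β × b′ β) public

  ╲-∩-Witnessed-finite : (b : Subset B) → Finite (b ∩ b′) → Finite ((g ╲ b) ∩ Witnessed)
  ╲-∩-Witnessed-finite b b∩b′-fin =
    Finite-⊆ covered (Finite-⋃ (b ∩ b′) (λ β α → α ∈ witness β) b∩b′-fin
                                (λ β → witness β , λ _ α∈w → α∈w))
    where
      covered : ((g ╲ b) ∩ Witnessed) ⊆ (λ α → ∃ λ β → (b ∩ b′) β × α ∈ witness β)
      covered (α∈g╲b , β , α∈w) =
        let (_ , gαβ , b′β) = witness-sound α∈w in β , (α∈g╲b β gαβ , b′β) , α∈w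

  image-finite : Finite (Witnessed ∩ a) → ((α : A) → Finite (g [ ｛ α ｝ ] ∩ b′))
               → Finite (b′ ∩ g [ a ])
  image-finite W∩a-fin singleton-fin =
    Finite-⊆ covered (Finite-⋃ (Witnessed ∩ a) (λ α → g [ ｛ α ｝ ] ∩ b′) W∩a-fin singleton-fin)
    where
      covered : (b′ ∩ g [ a ]) ⊆ (λ β → ∃ λ α → (Witnessed ∩ a) α × (g [ ｛ α ｝ ] ∩ b′) β)
      covered {β} (b′β , (α₀ , aα₀ , gα₀β)) =
        let (α , α∈w) = witness-complete (α₀ , aα₀ , gα₀β , b′β)
            (aα , gαβ , _) = witness-sound α∈w
        in α , ((β , α∈w) , aα) , ((α , refl , gαβ) , b′β)

module _ (em : ExcludedMiddle 0ℓ) {A I : Set} (ℬ : I → FinitenessSpace)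
         (f : (i : I) → Rel A (web (ℬ i)))
         (singletons : (α : A) (i : I) → 𝔉 (ℬ i) (f i [ ｛ α ｝ ])) where

  private
    𝔇 : Pred (Subset A) (lsuc 0ℓ)
    𝔇 = InterFamily ℬ f

  -- a ∈ 𝔗 lies in the member ⋂ᵢ (fᵢ \ fᵢ[a]) of 𝔇.
  𝔗⊆𝔇⊥⊥ : 𝔗 ℬ f ⊆ ((𝔇 ⊥) ⊥)
  𝔗⊆𝔇⊥⊥ {a} a∈𝔗 c′ c′⊥ =
    Finite-⊆ (λ (c′α , aα) → (λ i → ⊆-╲-image (f i) aα) , c′α)
             (c′⊥ _ ((λ i → f i [ a ]) , a∈𝔗 , id , id))

  -- fᵢ[a] is orthogonal to every b′ ∈ 𝔉(ℬᵢ)⊥, via the witness set of fᵢ[a] ∩ b′.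
  𝔇⊥⊥⊆𝔗 : ((𝔇 ⊥) ⊥) ⊆ 𝔗 ℬ f
  𝔇⊥⊥⊆𝔗 {a} a∈𝔇⊥⊥ i = proj₁ (isFS (ℬ i)) image∈𝔉⊥⊥
    where
      image∈𝔉⊥⊥ : ((𝔉 (ℬ i) ⊥) ⊥) (f i [ a ])
      image∈𝔉⊥⊥ b′ b′⊥ = image-finite (a∈𝔇⊥⊥ Witnessed Witnessed∈𝔇⊥) (λ α → b′⊥ _ (singletons α i))
        where
          open ImageWitnesses em (f i) a b′
          Witnessed∈𝔇⊥ : (𝔇 ⊥) Witnessed
          Witnessed∈𝔇⊥ d (b , b∈𝔉 , d⊆⋂ , _) =
            Finite-⊆ (λ (dα , w) → d⊆⋂ dα i , w) (╲-∩-Witnessed-finite (b i) (b′⊥ (b i) (b∈𝔉 i)))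

  𝔗≐𝔇⊥⊥ : 𝔗 ℬ f ≐ ((𝔇 ⊥) ⊥)
  𝔗≐𝔇⊥⊥ = 𝔗⊆𝔇⊥⊥ , 𝔇⊥⊥⊆𝔗

corollary1 : ExcludedMiddle 0ℓ → ExcludedMiddle (lsuc 0ℓ)
    → (A I : Set) (ℬ : I → FinitenessSpace) (f : (i : I) → Rel A (web (ℬ i)))
    → ((α : A) (i : I) → 𝔉 (ℬ i) (f i [ ｛ α ｝ ]))
    → IsFinitenessStructure (𝔗 ℬ f)
      × (𝔗 ℬ f ≐ ((InterFamily ℬ f ⊥) ⊥))
corollary1 em _ A I ℬ f singletons =
  IsFinitenessStructure-≐ 𝔗≐ (⊥-isFinitenessStructure (InterFamily ℬ f ⊥)) , 𝔗≐
  where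
    𝔗≐ : 𝔗 ℬ f ≐ ((InterFamily ℬ f ⊥) ⊥)
    𝔗≐ = 𝔗≐𝔇⊥⊥ em ℬ f singletons
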